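{- Let $H$ be any outcome of the spanner construction below. Let $0\le i<k$, fix $x,y\in V$, and let $m=\max\{d_G(x,p_i(x)),d_G(y,p_i(y)),d_G(x,y)\}$. Then at least one of the following holds: (1) $d_H(x,y)\le 5m$; (2) $d_H(x,p_{i+1}(x))\le 7m$.
   Context: Let $G=(V,E,w)$ be an undirected graph on $n$ vertices with non-negative edge weights, $d_G$ its shortest-path distance, and $k\ge1$ an integer; $\nu=1/((4/3)^k-1)$. For $x,y\in V$, $P_{xy}$ is a shortest $x$–$y$ path in $G$ (ties broken consistently). Let $A_0=V$, $A_k=\emptyset$, and for $0\le i\le k-2$ let $A_{i+1}$ be obtained by including each element of $A_i$ independently with probability $q_i=n^{ -4^i\nu/3^{i+1}}$. For $0\le i\le k-1$ and $v\in V$, the pivot $p_i(v)$ is the vertex of $A_i$ closest to $v$ in $d_G$ (ties broken lexicographically), so $p_0(v)=v$; $p_k(v)$ does not exist, and a condition bounding the distance from $x$ to $p_k(x)$ is regarded as false. Let $d_G(u,A_{i+1})=\min_{a\in A_{i+1}}d_G(u,a)$ ($=\infty$ if $A_{i+1}=\emptyset$). For $u\in A_i\setminus A_{i+1}$ the half bunch is $B_{1/2}(u)=\{v\in A_i: d_G(u,v)<d_G(u,A_{i+1})/2\}\cup\{p_j(u):i<j<k\}$. $H$ is the subgraph of $G$ formed by the union of the shortest paths $P_{uv}$ over all $u\in V$, $v\in B_{1/2}(u)$; $d_H$ is its shortest-path distance.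
   Formalization: The edge weights of G are non-negative rationals. -}

module Defs where

open import Data.Nat using (ℕ; zero; suc) renaming (_<_ to _<ℕ_; _≤_ to _≤ℕ_)
open import Data.Fin using (Fin; toℕ)
open import Data.Bool using (Bool; true; false)
open import Data.Maybe using (Maybe; just)
open import Data.Integer using (+_)
open import Data.Rational using (ℚ; 0ℚ; _+_; _*_; _≤_; _<_; _⊔_; _/_)
open import Data.Product using (Σ; ∃; ∃-syntax; _×_)
open import Data.Sum using (_⊎_)
open import Relation.Binary.PropositionalEquality using (_≡_)
open import Relation.Nullary using (¬_)

record WGraph (n : ℕ) : Set where
  field
    adj      : Fin n → Fin n → Bool
    w        : Fin n → Fin n → ℚ
    adj-sym  : ∀ u v → adj u v ≡ adj v u
    w-sym    : ∀ u v → w u v ≡ w v u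
    w-nonneg : ∀ u v → 0ℚ ≤ w u v

module _ {n : ℕ} where

  data Walk (E : Fin n → Fin n → Set) : Fin n → Fin n → Set where
    []   : ∀ {u} → Walk E u u
    step : ∀ {u v t} → E u v → Walk E v t → Walk E u t

  weight : ∀ {E u v} → (Fin n → Fin n → ℚ) → Walk E u v → ℚ
  weight w [] = 0ℚ
  weight w (step {u} {v} _ r) = w u v + weight w r

  data Traverses {E : Fin n → Fin n → Set} (a b : Fin n) : ∀ {u t} → Walk E u t → Set where
    here  : ∀ {t} (e : E a b) (r : Walk E b t) → Traverses a b (step e r)
    there : ∀ {u v t} (e : E u v) {r : Walk E v t} → Traverses a b r → Traverses a b (step e r)

module _ {n : ℕ} (G : WGraph n) where
  open WGraph G

  GE : Fin n → Fin n → Set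
  GE u v = adj u v ≡ true

  GWalk : Fin n → Fin n → Set
  GWalk = Walk GE

  IsDist : Fin n → Fin n → ℚ → Set
  IsDist u v d = (Σ (GWalk u v) λ p → weight w p ≡ d) × (∀ (q : GWalk u v) → d ≤ weight w q)

  IsClosest : (Fin n → Bool) → Fin n → Fin n → Set
  IsClosest A v p = A p ≡ true × Σ ℚ λ dp → IsDist v p dp ×
    (∀ a → A a ≡ true → ∀ da → IsDist v a da → dp < da ⊎ (dp ≡ da × toℕ p ≤ℕ toℕ a))

  IsPivot : (ℕ → Fin n → Bool) → ℕ → Fin n → Fin n → Set
  IsPivot A zero    v p = p ≡ v
  IsPivot A (suc i) v p = IsClosest (A (suc i)) v p

  ValidLevels : ℕ → (ℕ → Fin n → Bool) → Set
  ValidLevels k A = (∀ v → A 0 v ≡ true) × (∀ v → A k v ≡ false) ×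
                    (∀ i v → suc i <ℕ k → A (suc i) v ≡ true → A i v ≡ true)

  InHalfBunch : ℕ → (ℕ → Fin n → Bool) → Fin n → Fin n → Set
  InHalfBunch k A u v = ∃[ i ] (i <ℕ k × A i u ≡ true × A (suc i) u ≡ false ×
      ( (A i v ≡ true × Σ ℚ λ dv → IsDist u v dv ×
           (∀ a → A (suc i) a ≡ true → ∀ da → IsDist u a da → dv + dv < da))
      ⊎ (∃[ j ] (i <ℕ j × j <ℕ k × IsPivot A j u v))))

  IsShortestChoice : (∀ u v → Maybe (GWalk u v)) → Set
  IsShortestChoice P = ∀ u v → GWalk u v →
    Σ (GWalk u v) λ p → P u v ≡ just p × (∀ (q : GWalk u v) → weight w p ≤ weight w q)

  HE : ℕ → (ℕ → Fin n → Bool) → (∀ u v → Maybe (GWalk u v)) → Fin n → Fin n → Set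
  HE k A P a b = ∃[ u ] ∃[ v ] (InHalfBunch k A u v × Σ (GWalk u v) λ p → P u v ≡ just p ×
                   (Traverses a b p ⊎ Traverses b a p))

  DistHLe : ℕ → (ℕ → Fin n → Bool) → (∀ u v → Maybe (GWalk u v)) → Fin n → Fin n → ℚ → Set
  DistHLe k A P u v c = Σ (Walk (HE k A P) u v) λ p → weight w p ≤ c

⟦_⟧ : ℕ → ℚ
⟦ c ⟧ = + c / 1

{-# OPTIONS --safe #-}

-- Write a = p_i(x) and b = p_i(y), so d(a,b) ≤ 3m.  If some vertex of A_{i+1}
-- lies within 2 d(a,b) of a, then p_{i+1}(x) lies within m + 6m of x;
-- otherwise a ∉ A_{i+1} and b ∈ B_{1/2}(a), so P_{ab} ⊆ H and
-- d_H(x,y) ≤ m + 3m + m.  Both cases use that H contains a shortest path from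
-- every vertex to each of its pivots.  Zero edge weights make this subtle: a
-- vertex u ∈ A_j may have p_j(u) ≠ u at distance 0.  All vertices at distance
-- 0 from u (its twins) are joined in H to the closest vertex of the highest
-- level that contains a twin, since it lies in each of their half bunches.

module Submission where

open import Defs
open import Data.Nat using (ℕ; suc) renaming (_<_ to _<ℕ_; _≤_ to _≤ℕ_)
open import Data.Fin using (Fin)
open import Data.Bool using (Bool)
open import Data.Maybe using (Maybe)
open import Data.Rational using (ℚ; _*_; _⊔_)
open import Data.Product using (Σ; ∃-syntax; _×_)
open import Data.Sum using (_⊎_)

open import Data.Nat using (zero) renaming (_≥_ to _≥ℕ_)
import Data.Nat.Properties as ℕP
open import Data.Fin using (toℕ)
open import Data.Fin.Properties using (any?)
open import Data.Bool using (true; false)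
import Data.Bool as Bool
open import Data.Bool.Properties using (¬-not)
open import Data.Maybe using (just; nothing)
open import Data.Rational using (0ℚ; _+_; _≤_; _<_)
import Data.Rational.Properties as ℚP
open import Data.Rational.Solver using (module +-*-Solver)
open import Data.Product using (∃; _,_; proj₁; proj₂)
open import Data.Product.Relation.Binary.Lex.Strict using (×-Lex; ×-transitive; ×-total₂)
open import Data.Sum using (inj₁; inj₂; swap)
import Data.Sum as Sum
open import Data.List using (List; []; _∷_; upTo; allFin)
open import Data.List.Relation.Unary.Any using (Any; here; there)
  renaming (any? to anyᴸ?)
open import Data.List.Membership.Propositional using (_∈_; lose)
open import Data.List.Membership.Propositional.Properties using (∈-allFin; ∈-upTo⁺; ∈-upTo⁻)
open import Data.Empty using (⊥-elim)
open import Function using (id)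
open import Relation.Nullary using (¬_; Dec; yes; no)
open import Relation.Nullary.Decidable using (map′; _×-dec_)
open import Relation.Unary using (Decidable)
open import Relation.Binary.Definitions using (Total; Transitive; tri<; tri≈; tri>)
open import Relation.Binary.PropositionalEquality

module _ {n : ℕ} {E : Fin n → Fin n → Set} where

  infixr 5 _++_
  _++_ : ∀ {u v t} → Walk E u v → Walk E v t → Walk E u t
  [] ++ q = q
  step e p ++ q = step e (p ++ q)

  reverse : (∀ {a b} → E a b → E b a) → ∀ {u v} → Walk E u v → Walk E v u
  reverse flip [] = []
  reverse flip (step e p) = reverse flip p ++ step (flip e) []

  mapTraversed : ∀ {E′ : Fin n → Fin n → Set} {u v} (p : Walk E u v) →
                 (∀ {a b} → Traverses a b p → E′ a b) → Walk E′ u v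
  mapTraversed [] f = []
  mapTraversed (step e p) f = step (f (here e p)) (mapTraversed p (λ t → f (there e t)))

  module _ (w : Fin n → Fin n → ℚ) where

    weight-++ : ∀ {u v t} (p : Walk E u v) (q : Walk E v t) →
                weight w (p ++ q) ≡ weight w p + weight w q
    weight-++ [] q = sym (ℚP.+-identityˡ _)
    weight-++ (step {u} {v} e p) q =
      trans (cong (w u v +_) (weight-++ p q)) (sym (ℚP.+-assoc (w u v) _ _))

    weight-reverse : (∀ a b → w a b ≡ w b a) → (flip : ∀ {a b} → E a b → E b a) →
                     ∀ {u v} (p : Walk E u v) → weight w (reverse flip p) ≡ weight w p
    weight-reverse w-sym flip [] = refl
    weight-reverse w-sym flip (step {u} {v} e p) = begin
      weight w (reverse flip p ++ step (flip e) [])  ≡⟨ weight-++ (reverse flip p) _ ⟩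
      weight w (reverse flip p) + (w v u + 0ℚ)       ≡⟨ cong₂ _+_ (weight-reverse w-sym flip p)
                                                                  (ℚP.+-identityʳ (w v u)) ⟩
      weight w p + w v u                              ≡⟨ cong (weight w p +_) (w-sym v u) ⟩
      weight w p + w u v                              ≡⟨ ℚP.+-comm (weight w p) (w u v) ⟩
      w u v + weight w p                              ∎
      where open ≡-Reasoning

    weight-nonneg : (∀ a b → 0ℚ ≤ w a b) → ∀ {u v} (p : Walk E u v) → 0ℚ ≤ weight w p
    weight-nonneg w≥0 [] = ℚP.≤-refl
    weight-nonneg w≥0 (step {u} e p) = ℚP.+-mono-≤ (w≥0 u _) (weight-nonneg w≥0 p)

    weight-mapTraversed : ∀ {E′ : Fin n → Fin n → Set} {u v} (p : Walk E u v)
                          (f : ∀ {a b} → Traverses a b p → E′ a b) →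
                          weight w (mapTraversed p f) ≡ weight w p
    weight-mapTraversed [] f = refl
    weight-mapTraversed (step {u} {v} e p) f =
      cong (w u v +_) (weight-mapTraversed p (λ t → f (there e t)))

drop-below : (B : ℕ → Bool) → B 0 ≡ true → ∀ j → B j ≡ false →
             ∃[ l ] (l <ℕ j × B l ≡ true × B (suc l) ≡ false)
drop-below B B0 zero Bj with () ← trans (sym B0) Bj
drop-below B B0 (suc j) Bsj with B j in Bj
... | true = j , ℕP.≤-refl , Bj , Bsj
... | false with l , l<j , Bl , ¬Bsl ← drop-below B B0 j Bj = l , ℕP.m<n⇒m<1+n l<j , Bl , ¬Bsl

module _ {X K : Set} {Q : X → Set} (Q? : Decidable Q)
         (key : ∀ {x} → Q x → K) (key-unique : ∀ {x} (q q′ : Q x) → key q ≡ key q′)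
         {_≼_ : K → K → Set} (≼-total : Total _≼_) (≼-trans : Transitive _≼_) where

  private
    ≼-refl : ∀ {κ} → κ ≼ κ
    ≼-refl {κ} = Sum.[ id , id ] (≼-total κ κ)

  IsLeast : List X → X → Set
  IsLeast L m = m ∈ L × Σ (Q m) λ qm → ∀ {b} → b ∈ L → (qb : Q b) → key qm ≼ key qb

  least : ∀ L → Any Q L → ∃ (IsLeast L)
  least (x ∷ L) qxL with anyᴸ? Q? L | qxL
  ... | no ¬qL | there qL = ⊥-elim (¬qL qL)
  ... | no ¬qL | here qx = x , here refl , qx , x-least
    where
    x-least : ∀ {b} → b ∈ x ∷ L → (qb : Q b) → key qx ≼ key qb
    x-least (here refl) qb = subst (key qx ≼_) (key-unique qx qb) ≼-refl
    x-least (there b∈L) qb = ⊥-elim (¬qL (lose b∈L qb))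
  ... | yes qL | _ with m , m∈L , qm , m-least ← least L qL | Q? x
  ...   | no ¬qx = m , there m∈L , qm , λ { (here refl) qb → ⊥-elim (¬qx qb)
                                         ; (there b∈L) → m-least b∈L }
  ...   | yes qx with ≼-total (key qm) (key qx)
  ...     | inj₁ m≼x = m , there m∈L , qm , λ
                { (here refl) qb → subst (key qm ≼_) (key-unique qx qb) m≼x
                ; (there b∈L) → m-least b∈L }
  ...     | inj₂ x≼m = x , here refl , qx , λ
                { (here refl) qb → subst (key qx ≼_) (key-unique qx qb) ≼-refl
                ; (there b∈L) qb → ≼-trans x≼m (m-least b∈L qb) }

largest-below : {Z : ℕ → Set} → Decidable Z → ∀ {k} → 0 <ℕ k → Z 0 →
                ∃[ T ] (T <ℕ k × Z T × ∀ {j} → j <ℕ k → Z j → j ≤ℕ T)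
largest-below Z? {k} 0<k Z0
  with T , T∈ , ZT , T-max ← least Z? (λ {j} _ → j) (λ _ _ → refl) {_≥ℕ_}
                                   (λ i j → ℕP.≤-total j i) (λ i≥j j≥l → ℕP.≤-trans j≥l i≥j)
                                   (upTo k) (lose (∈-upTo⁺ 0<k) Z0)
  = T , ∈-upTo⁻ T∈ , ZT , λ j<k Zj → T-max (∈-upTo⁺ j<k) Zj

module _ {M : ℚ} where
  open +-*-Solver using (solve; _:+_; _:*_; _:=_; con)

  five-bound : ∀ {a b c} → a ≤ M → b ≤ (M + M) + M → c ≤ M → a + (b + c) ≤ ⟦ 5 ⟧ * M
  five-bound a≤ b≤ c≤ = subst (_ ≤_) (five M) (ℚP.+-mono-≤ a≤ (ℚP.+-mono-≤ b≤ c≤))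
    where
    five : ∀ M → M + (((M + M) + M) + M) ≡ ⟦ 5 ⟧ * M
    five = solve 1 (λ M → M :+ (((M :+ M) :+ M) :+ M) := con ⟦ 5 ⟧ :* M) refl

  seven-bound : ∀ {a b} → a ≤ M → b ≤ (M + M) + M → a + (b + b) ≤ ⟦ 7 ⟧ * M
  seven-bound a≤ b≤ = subst (_ ≤_) (seven M) (ℚP.+-mono-≤ a≤ (ℚP.+-mono-≤ b≤ b≤))
    where
    seven : ∀ M → M + (((M + M) + M) + ((M + M) + M)) ≡ ⟦ 7 ⟧ * M
    seven = solve 1 (λ M → M :+ (((M :+ M) :+ M) :+ ((M :+ M) :+ M)) := con ⟦ 7 ⟧ :* M) refl

module Distance {n : ℕ} (G : WGraph n) where
  open WGraph G

  GE-sym : ∀ {a b} → GE G a b → GE G b a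
  GE-sym {a} {b} e = trans (adj-sym b a) e

  weight-reverseᴳ : ∀ {u v} (p : GWalk G u v) → weight w (reverse GE-sym p) ≡ weight w p
  weight-reverseᴳ = weight-reverse w w-sym GE-sym

  dist-unique : ∀ {u v d d′} → IsDist G u v d → IsDist G u v d′ → d ≡ d′
  dist-unique ((p , wp≡d) , d-min) ((p′ , wp′≡d′) , d′-min) =
    ℚP.≤-antisym (subst (_ ≤_) wp′≡d′ (d-min p′)) (subst (_ ≤_) wp≡d (d′-min p))

  dist-nonneg : ∀ {u v d} → IsDist G u v d → 0ℚ ≤ d
  dist-nonneg ((p , wp≡d) , _) = subst (0ℚ ≤_) wp≡d (weight-nonneg w w-nonneg p)

  dist-refl : ∀ u → IsDist G u u 0ℚ
  dist-refl u = ([] , refl) , weight-nonneg w w-nonneg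

  dist-sym : ∀ {u v d} → IsDist G u v d → IsDist G v u d
  dist-sym ((p , wp≡d) , d-min) =
    (reverse GE-sym p , trans (weight-reverseᴳ p) wp≡d) ,
    λ q → subst (_ ≤_) (weight-reverseᴳ q) (d-min (reverse GE-sym q))

  dist-zero-trans : ∀ {u v t d} → IsDist G u v 0ℚ → IsDist G v t d → IsDist G u t d
  dist-zero-trans {d = d} ((p , wp≡0) , _) ((q , wq≡d) , d-min) =
    (p ++ q , trans (weight-++ w p q) (trans (cong₂ _+_ wp≡0 wq≡d) (ℚP.+-identityˡ d))) , λ r → begin
      d                                       ≤⟨ d-min (reverse GE-sym p ++ r) ⟩
      weight w (reverse GE-sym p ++ r)        ≡⟨ weight-++ w (reverse GE-sym p) r ⟩
      weight w (reverse GE-sym p) + weight w r ≡⟨ cong (_+ weight w r) (trans (weight-reverseᴳ p) wp≡0) ⟩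
      0ℚ + weight w r                         ≡⟨ ℚP.+-identityˡ (weight w r) ⟩
      weight w r                              ∎
    where open ℚP.≤-Reasoning

  closest-dist : ∀ {B v p} → IsClosest G B v p → ∃ (IsDist G v p)
  closest-dist (_ , dp , Ip , _) = dp , Ip

  closest-≤ : ∀ {B v p a da dp} → IsClosest G B v p → B a ≡ true →
              IsDist G v a da → IsDist G v p dp → dp ≤ da
  closest-≤ (_ , dp , Ip , p-min) Ba Ia Ip′ with p-min _ Ba _ Ia
  ... | inj₁ dp<da = subst (_≤ _) (dist-unique Ip Ip′) (ℚP.<⇒≤ dp<da)
  ... | inj₂ (dp≡da , _) = subst (_≤ _) (dist-unique Ip Ip′) (ℚP.≤-reflexive dp≡da)

  closest-twin : ∀ {B v p a} → IsClosest G B v p → B a ≡ true → IsDist G v a 0ℚ → IsDist G v p 0ℚ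
  closest-twin p-cl Ba Ia with dp , Ip ← closest-dist p-cl =
    subst (IsDist G _ _) (ℚP.≤-antisym (closest-≤ p-cl Ba Ia Ip) (dist-nonneg Ip)) Ip

  closest-zero-trans : ∀ {B u v p} → IsDist G u v 0ℚ → IsClosest G B v p → IsClosest G B u p
  closest-zero-trans Iuv (Bp , dp , Ivp , p-min) =
    Bp , dp , dist-zero-trans Iuv Ivp ,
    λ a Ba da Iua → p-min a Ba da (dist-zero-trans (dist-sym Iuv) Iua)

module ShortestPaths {n : ℕ} (G : WGraph n) (P : ∀ u v → Maybe (GWalk G u v))
                     (P-shortest : IsShortestChoice G P) where
  open WGraph G
  open Distance G

  dist-exists : ∀ {u v} → GWalk G u v → ∃ (IsDist G u v)
  dist-exists {u} {v} q with p , _ , p-min ← P-shortest u v q = weight w p , (p , refl) , p-min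

  dist? : ∀ u v → Dec (∃ (IsDist G u v))
  dist? u v with P u v in Puv
  ... | just p = yes (dist-exists p)
  ... | nothing = no λ (_ , (q , _) , _) →
          case-nothing (trans (sym Puv) (proj₁ (proj₂ (P-shortest u v q))))
    where
    case-nothing : ∀ {p : GWalk G u v} → nothing ≢ just p
    case-nothing ()

  IsDist? : ∀ u v d → Dec (IsDist G u v d)
  IsDist? u v d with dist? u v
  ... | no ∄d = no λ I → ∄d (d , I)
  ... | yes (d′ , I) = map′ (λ d′≡d → subst (IsDist G u v) d′≡d I) (dist-unique I) (d′ ℚP.≟ d)

  dist-≤? : ∀ u v c → Dec (∃[ d ] (IsDist G u v d × d ≤ c))
  dist-≤? u v c with dist? u v
  ... | no ∄d = no λ (d , I , _) → ∄d (d , I)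
  ... | yes (d , I) = map′ (λ d≤c → d , I , d≤c)
                           (λ (d′ , I′ , d′≤c) → subst (_≤ c) (dist-unique I′ I) d′≤c) (d ℚP.≤? c)

  triangle : ∀ {u v t d₁ d₂} → IsDist G u v d₁ → IsDist G v t d₂ →
             ∃[ d ] (IsDist G u t d × d ≤ d₁ + d₂)
  triangle ((p , wp≡d₁) , _) ((q , wq≡d₂) , _) with d , I ← dist-exists (p ++ q) =
    d , I , subst (d ≤_) (trans (weight-++ w p q) (cong₂ _+_ wp≡d₁ wq≡d₂)) (proj₂ I (p ++ q))

  DistIndexLex : (ℚ × ℕ) → (ℚ × ℕ) → Set
  DistIndexLex = ×-Lex _≡_ _<_ _≤ℕ_

  closest-exists : ∀ {B v a d} → B a ≡ true → IsDist G v a d → ∃ (IsClosest G B v)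
  closest-exists {B} {v} {a} Ba Ia
    with p , _ , (Bp , dp , Ip) , p-least ←
           least (λ b → (B b Bool.≟ true) ×-dec dist? v b) (λ {b} (_ , db , _) → db , toℕ b)
                 (λ (_ , _ , I) (_ , _ , I′) → cong (_, _) (dist-unique I I′)) {DistIndexLex}
                 (×-total₂ {_≈₁_ = _≡_} {_<₁_ = _<_} {_<₂_ = _≤ℕ_} sym ℚP.<-cmp ℕP.≤-total)
                 (×-transitive {_≈₁_ = _≡_} {_<₁_ = _<_} {_<₂_ = _≤ℕ_}
                               isEquivalence (resp₂ _<_) ℚP.<-trans ℕP.≤-trans)
                 (allFin n) (lose (∈-allFin a) (Ba , _ , Ia))
    = p , Bp , dp , Ip , λ b Bb db Ib → p-least (∈-allFin b) (Bb , db , Ib)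

module Spanner {n : ℕ} (k : ℕ) (k≥1 : 1 ≤ℕ k) (G : WGraph n) (A : ℕ → Fin n → Bool)
               (A-valid : ValidLevels G k A) (P : ∀ u v → Maybe (GWalk G u v))
               (P-shortest : IsShortestChoice G P) where
  open WGraph G
  open Distance G
  open ShortestPaths G P P-shortest

  A₀-full : ∀ v → A 0 v ≡ true
  A₀-full = proj₁ A-valid

  Aₖ-empty : ∀ v → A k v ≡ false
  Aₖ-empty = proj₁ (proj₂ A-valid)

  DistH≤ : Fin n → Fin n → ℚ → Set
  DistH≤ = DistHLe G k A P

  HE-sym : ∀ {a b} → HE G k A P a b → HE G k A P b a
  HE-sym (u , v , v∈B , p , Puv , t) = u , v , v∈B , p , Puv , swap t

  distH-sym : ∀ {u v c} → DistH≤ u v c → DistH≤ v u c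
  distH-sym (p , wp≤c) = reverse HE-sym p , subst (_≤ _) (sym (weight-reverse w w-sym HE-sym p)) wp≤c

  distH-trans : ∀ {u v t c c′} → DistH≤ u v c → DistH≤ v t c′ → DistH≤ u t (c + c′)
  distH-trans (p , wp≤c) (q , wq≤c′) =
    p ++ q , subst (_≤ _) (sym (weight-++ w p q)) (ℚP.+-mono-≤ wp≤c wq≤c′)

  distH-mono : ∀ {u v c c′} → DistH≤ u v c → c ≤ c′ → DistH≤ u v c′
  distH-mono (p , wp≤c) c≤c′ = p , ℚP.≤-trans wp≤c c≤c′

  halfBunch-distH : ∀ {u v d} → InHalfBunch G k A u v → IsDist G u v d → DistH≤ u v d
  halfBunch-distH {u} {v} v∈B ((q , wq≡d) , _) with p , Puv , p-min ← P-shortest u v q =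
    mapTraversed p (λ t → u , v , v∈B , p , Puv , inj₁ t) ,
    subst (_≤ _) (sym (weight-mapTraversed w p _)) (subst (weight w p ≤_) wq≡d (p-min q))

  level : ∀ u → ∃[ l ] (l <ℕ k × A l u ≡ true × A (suc l) u ≡ false)
  level u = drop-below (λ j → A j u) (A₀-full u) k (Aₖ-empty u)

  inhabited-level<k : ∀ {i a} → i <ℕ k → A (suc i) a ≡ true → suc i <ℕ k
  inhabited-level<k {a = a} i<k Aa with ℕP.m≤n⇒m<n∨m≡n i<k
  ... | inj₁ si<k = si<k
  ... | inj₂ refl with () ← trans (sym Aa) (Aₖ-empty a)

  closest⇒pivot : ∀ {l T v p} → l <ℕ T → IsClosest G (A T) v p → IsPivot G A T v p
  closest⇒pivot {T = suc T} _ p-cl = p-cl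

  HasTwinAt : Fin n → ℕ → Set
  HasTwinAt v j = ∃[ a ] (A j a ≡ true × IsDist G v a 0ℚ)

  HasTwinAt? : ∀ v → Decidable (HasTwinAt v)
  HasTwinAt? v j = any? λ a → (A j a Bool.≟ true) ×-dec IsDist? v a 0ℚ

  NoTwinAbove : Fin n → ℕ → Set
  NoTwinAbove v T = ∀ {j} → T <ℕ j → j <ℕ k → ¬ HasTwinAt v j

  top-twin-level : ∀ v → ∃[ T ] (T <ℕ k × HasTwinAt v T × NoTwinAbove v T)
  top-twin-level v
    with T , T<k , twin , T-max ← largest-below (HasTwinAt? v) k≥1 (v , A₀-full v , dist-refl v)
    = T , T<k , twin , λ T<j j<k twinⱼ → ℕP.<⇒≱ T<j (T-max j<k twinⱼ)

  top-closest-in-halfBunch : ∀ {T v t u} → T <ℕ k → NoTwinAbove v T →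
                             IsClosest G (A T) v t → IsDist G v u 0ℚ → InHalfBunch G k A u t
  top-closest-in-halfBunch {T} {t = t} {u} T<k no-twin t-cl Ivu
    with l , l<k , Alu , ¬Aslu ← level u | ℕP.<-cmp l T
  ... | tri> _ _ T<l = ⊥-elim (no-twin T<l l<k (u , Alu , Ivu))
  ... | tri< l<T _ _ =
        l , l<k , Alu , ¬Aslu ,
        inj₂ (T , l<T , T<k , closest⇒pivot l<T (closest-zero-trans (dist-sym Ivu) t-cl))
  ... | tri≈ _ refl _ = l , l<k , Alu , ¬Aslu , inj₁ (proj₁ t-cl , 0ℚ , Iut , A₁₊ₗ-far)
    where
    Iut : IsDist G u t 0ℚ
    Iut = dist-zero-trans (dist-sym Ivu) (closest-twin t-cl Alu Ivu)
    A₁₊ₗ-far : ∀ a → A (suc l) a ≡ true → ∀ da → IsDist G u a da → 0ℚ < da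
    A₁₊ₗ-far a Aa da Iua = ℚP.≰⇒> λ da≤0 →
      no-twin (ℕP.n<1+n l) (inhabited-level<k l<k Aa)
              (a , Aa , dist-zero-trans Ivu (subst (IsDist G u a) (ℚP.≤-antisym da≤0 (dist-nonneg Iua)) Iua))

  twin-distH : ∀ {u v} → IsDist G u v 0ℚ → DistH≤ u v 0ℚ
  twin-distH {u} Iuv
    with T , T<k , (a , Aa , Iua) , no-twin ← top-twin-level u
    with t , t-cl ← closest-exists Aa Iua
    = distH-trans (reaches-t (dist-refl u)) (distH-sym (reaches-t Iuv))
    where
    reaches-t : ∀ {v′} → IsDist G u v′ 0ℚ → DistH≤ v′ t 0ℚ
    reaches-t Iuv′ = halfBunch-distH (top-closest-in-halfBunch T<k no-twin t-cl Iuv′)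
                       (dist-zero-trans (dist-sym Iuv′) (closest-twin t-cl Aa Iua))

  pivot-distH : ∀ {j v p d} → j <ℕ k → IsPivot G A j v p → IsDist G v p d → DistH≤ v p d
  pivot-distH {zero} _ refl Ivp = [] , dist-nonneg Ivp
  pivot-distH {suc j} {v} {p} j<k p-cl Ivp with A (suc j) v in Av
  ... | true = distH-mono (twin-distH (subst (IsDist G v p) d≡0 Ivp)) (dist-nonneg Ivp)
    where
    d≡0 = ℚP.≤-antisym (closest-≤ p-cl Av (dist-refl v) Ivp) (dist-nonneg Ivp)
  ... | false with l , l<sj , Alv , ¬Aslv ← drop-below (λ i → A i v) (A₀-full v) (suc j) Av =
        halfBunch-distH (l , ℕP.<-trans l<sj j<k , Alv , ¬Aslv , inj₂ (suc j , l<sj , j<k , p-cl)) Ivp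

  next-pivot-distH : ∀ {i x a d c} → i <ℕ k → A (suc i) a ≡ true → IsDist G x a d → d ≤ c →
                     ∃[ p ] (IsPivot G A (suc i) x p × DistH≤ x p c)
  next-pivot-distH i<k Aa Ixa d≤c with p , p-cl ← closest-exists Aa Ixa | closest-dist p-cl
  ... | _ , Ixp = p , p-cl ,
        distH-mono (pivot-distH (inhabited-level<k i<k Aa) p-cl Ixp) (ℚP.≤-trans (closest-≤ p-cl Aa Ixa Ixp) d≤c)

  NextLevelWithin : ℕ → Fin n → ℚ → Set
  NextLevelWithin i u c = ∃[ a ] (A (suc i) a ≡ true × ∃[ d ] (IsDist G u a d × d ≤ c))

  halfBunch-unless-nextLevel : ∀ {i u v d} → i <ℕ k → A i u ≡ true → A i v ≡ true → IsDist G u v d →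
                               ¬ NextLevelWithin i u (d + d) → InHalfBunch G k A u v
  halfBunch-unless-nextLevel {i} {u} {d = d} i<k Aiu Aiv Iuv ¬near =
    i , i<k , Aiu , ¬-not u∉Aᵢ₊₁ ,
    inj₁ (Aiv , d , Iuv , λ a Aa da Iua → ℚP.≰⇒> λ da≤ → ¬near (a , Aa , da , Iua , da≤))
    where
    u∉Aᵢ₊₁ : ¬ A (suc i) u ≡ true
    u∉Aᵢ₊₁ Au = ¬near (u , Au , 0ℚ , dist-refl u , ℚP.+-mono-≤ (dist-nonneg Iuv) (dist-nonneg Iuv))

  pivot-∈ : ∀ {i v p} → IsPivot G A i v p → A i p ≡ true
  pivot-∈ {zero} {v} refl = A₀-full v
  pivot-∈ {suc i} p-cl = proj₁ p-cl

  nextLevelWithin? : ∀ i u c → Dec (NextLevelWithin i u c)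
  nextLevelWithin? i u c = any? λ a → (A (suc i) a Bool.≟ true) ×-dec dist-≤? u a c

  pivot-dichotomy : ∀ {i x y px py dx dy dab} → i <ℕ k → IsPivot G A i x px → IsPivot G A i y py →
                    IsDist G x px dx → IsDist G y py dy → IsDist G px py dab →
                    DistH≤ x y (dx + (dab + dy))
                    ⊎ ∃[ p ] (IsPivot G A (suc i) x p × DistH≤ x p (dx + (dab + dab)))
  pivot-dichotomy {i} {px = px} {dx = dx} {dab = dab} i<k px-piv py-piv Ixpx Iypy Iab
    with nextLevelWithin? i px (dab + dab)
  ... | yes (a , Aa , da , Ia , da≤) with dxa , Ixa , dxa≤ ← triangle Ixpx Ia =
        inj₂ (next-pivot-distH i<k Aa Ixa (ℚP.≤-trans dxa≤ (ℚP.+-monoʳ-≤ dx da≤)))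
  ... | no ¬near = inj₁ (distH-trans (pivot-distH i<k px-piv Ixpx)
                         (distH-trans (halfBunch-distH py∈B Iab) (distH-sym (pivot-distH i<k py-piv Iypy))))
    where
    py∈B = halfBunch-unless-nextLevel i<k (pivot-∈ px-piv) (pivot-∈ py-piv) Iab ¬near

  stretch : ∀ {i x y px py dx dy dxy M} → i <ℕ k → IsPivot G A i x px → IsPivot G A i y py →
            IsDist G x px dx → IsDist G y py dy → IsDist G x y dxy → dx ≤ M → dy ≤ M → dxy ≤ M →
            DistH≤ x y (⟦ 5 ⟧ * M) ⊎ ∃[ p ] (IsPivot G A (suc i) x p × DistH≤ x p (⟦ 7 ⟧ * M))
  stretch i<k px-piv py-piv Ixpx Iypy Ixy dx≤M dy≤M dxy≤M
    with dpxy , Ipxy , dpxy≤ ← triangle (dist-sym Ixpx) Ixy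
    with dab , Iab , dab≤ ← triangle Ipxy Iypy
    = Sum.map (λ H → distH-mono H (five-bound dx≤M dab≤3M dy≤M))
              (λ (p , p-piv , H) → p , p-piv , distH-mono H (seven-bound dx≤M dab≤3M))
              (pivot-dichotomy i<k px-piv py-piv Ixpx Iypy Iab)
    where
    dab≤3M = ℚP.≤-trans dab≤ (ℚP.+-mono-≤ (ℚP.≤-trans dpxy≤ (ℚP.+-mono-≤ dx≤M dxy≤M)) dy≤M)

lemmaD4 : (n k : ℕ) → 1 ≤ℕ k → (G : WGraph n) → (A : ℕ → Fin n → Bool) → ValidLevels G k A →
          (P : ∀ u v → Maybe (GWalk G u v)) → IsShortestChoice G P →
          (i : ℕ) → i <ℕ k → (x y px py : Fin n) → IsPivot G A i x px → IsPivot G A i y py →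
          (dx dy dxy : ℚ) → IsDist G x px dx → IsDist G y py dy → IsDist G x y dxy →
          DistHLe G k A P x y (⟦ 5 ⟧ * ((dx ⊔ dy) ⊔ dxy))
          ⊎ (∃[ p ] (IsPivot G A (suc i) x p × DistHLe G k A P x p (⟦ 7 ⟧ * ((dx ⊔ dy) ⊔ dxy))))
lemmaD4 n k k≥1 G A A-valid P P-shortest i i<k x y px py px-piv py-piv dx dy dxy Ixpx Iypy Ixy =
  stretch i<k px-piv py-piv Ixpx Iypy Ixy
    (ℚP.p≤q⇒p≤q⊔r dxy (ℚP.p≤p⊔q dx dy))
    (ℚP.p≤q⇒p≤q⊔r dxy (ℚP.p≤q⊔p dx dy))
    (ℚP.p≤q⊔p (dx ⊔ dy) dxy)
  where open Spanner k k≥1 G A A-valid P P-shortest
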